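{- For every integer $n \geq 3$, the chromatic number of the cubical staircase graph $CS_n$ is $$\chi(CS_n) = \begin{cases} 1, & n = 3,\\ 2, & n \geq 4.\end{cases}$$
   Context: For a natural number $n \geq 3$, the cubical staircase graph $CS_n$ is the graph with vertex set $\{(i,j,k) : 1 \leq i \leq n-2,\ 1 \leq j \leq i,\ 1 \leq k \leq n-1-i\}$ and edge set consisting of the pairs $(i,j,k)(i,j,k+1)$ for $1\le i\le n-2$, $1\le j\le i$, $1\le k\le n-2-i$; the pairs $(i,j,k)(i+1,j,k)$ for $1\le i\le n-3$, $1\le j\le i$, $1\le k\le n-1-i$; and the pairs $(i,j,k)(i,j+1,k)$ for $1\le i\le n-2$, $1\le j\le i-1$, $1\le k\le n-1-i$ (only pairs of vertices of $CS_n$ are included). -}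

module Defs where

open import Data.Nat using (ℕ; suc; _+_; _∸_; _≤_)
open import Data.Fin using (Fin)
open import Data.Product using (Σ; _×_; _,_; proj₁)
open import Data.Sum using (_⊎_)
open import Relation.Binary.PropositionalEquality using (_≡_; _≢_)

Triple : Set
Triple = ℕ × ℕ × ℕ

IsVertex : ℕ → Triple → Set
IsVertex n (i , j , k) =
  (1 ≤ i × i ≤ n ∸ 2) × (1 ≤ j × j ≤ i) × (1 ≤ k × k ≤ n ∸ 1 ∸ i)

Vertex : ℕ → Set
Vertex n = Σ Triple (IsVertex n)

-- Both endpoints must be vertices of CS_n; this
-- enforces all the index ranges listed in the definition.
Step : Triple → Triple → Set
Step (i , j , k) (i' , j' , k') =
  (i' ≡ i × j' ≡ j × k' ≡ suc k)
  ⊎ (i' ≡ suc i × j' ≡ j × k' ≡ k)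
  ⊎ (i' ≡ i × j' ≡ suc j × k' ≡ k)

Adj : (n : ℕ) → Vertex n → Vertex n → Set
Adj n u v = Step (proj₁ u) (proj₁ v) ⊎ Step (proj₁ v) (proj₁ u)

ProperColouring : (n c : ℕ) → (Vertex n → Fin c) → Set
ProperColouring n c f = ∀ u v → Adj n u v → f u ≢ f v

Colourable : (n c : ℕ) → Set
Colourable n c = Σ (Vertex n → Fin c) (ProperColouring n c)

IsChromaticNumber : (n χ : ℕ) → Set
IsChromaticNumber n χ = Colourable n χ × (∀ c → Colourable n c → χ ≤ c)

{-# OPTIONS --safe #-}
-- Every edge of CS_n raises the coordinate sum i + j + k by one, so colouring a
-- vertex by the parity of its coordinate sum is proper and CS_n is bipartite.
-- For n = 3 the only vertex is (1, 1, 1), so one colour suffices; for n ≥ 4 the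
-- edge (1, 1, 1)(1, 1, 2) exists, so two colours are needed.
module Submission where

open import Defs
open import Data.Nat using (ℕ; zero; suc; _+_; _≤_; z≤n; s≤s; >-nonZero⁻¹)
open import Data.Nat.Properties using (+-suc; 1+n≢n)
open import Data.Fin using (Fin; zero; suc; opposite)
open import Data.Fin.Properties using (nonZeroIndex)
open import Data.Product using (_×_; _,_; proj₁)
open import Data.Sum using (inj₁; inj₂)
open import Data.Empty using (⊥-elim)
open import Function using (_∘_)
open import Relation.Nullary using (¬_)
open import Relation.Binary.PropositionalEquality using (_≡_; _≢_; refl; sym; cong)

weight : Triple → ℕ
weight (i , j , k) = i + j + k

parity : ℕ → Fin 2
parity zero    = zero
parity (suc m) = opposite (parity m)

parity-suc≢ : ∀ m → parity (suc m) ≢ parity m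
parity-suc≢ m with parity m
... | zero     = λ ()
... | suc zero = λ ()

weight-Step : ∀ {a b} → Step a b → weight b ≡ suc (weight a)
weight-Step {i , j , k} (inj₁ (refl , refl , refl))        = +-suc (i + j) k
weight-Step             (inj₂ (inj₁ (refl , refl , refl))) = refl
weight-Step {i , j , k} (inj₂ (inj₂ (refl , refl , refl))) = cong (_+ k) (+-suc i j)

Step-irreflexive : ∀ {a} → ¬ Step a a
Step-irreflexive s = 1+n≢n (sym (weight-Step s))

Step⇒parity≢ : ∀ {a b} → Step a b → parity (weight a) ≢ parity (weight b)
Step⇒parity≢ {a} s eq rewrite weight-Step s = parity-suc≢ (weight a) (sym eq)

parityColouring : ∀ n → Vertex n → Fin 2
parityColouring n = parity ∘ weight ∘ proj₁

parityColouring-proper : ∀ n → ProperColouring n 2 (parityColouring n)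
parityColouring-proper n u v (inj₁ s) = Step⇒parity≢ s
parityColouring-proper n u v (inj₂ s) = Step⇒parity≢ s ∘ sym

Vertex⇒1≤colours : ∀ {n c} → Vertex n → Colourable n c → 1 ≤ c
Vertex⇒1≤colours {c = c} u (f , _) = >-nonZero⁻¹ c {{nonZeroIndex (f u)}}

distinct⇒2≤ : ∀ {c} (x y : Fin c) → x ≢ y → 2 ≤ c
distinct⇒2≤ {suc zero}    zero zero x≢y = ⊥-elim (x≢y refl)
distinct⇒2≤ {suc (suc _)} _    _    _   = s≤s (s≤s z≤n)

Adj⇒2≤colours : ∀ {n c} (u v : Vertex n) → Adj n u v → Colourable n c → 2 ≤ c
Adj⇒2≤colours u v uv (f , proper) = distinct⇒2≤ (f u) (f v) (proper u v uv)

CS₃-vertex : (v : Vertex 3) → proj₁ v ≡ (1 , 1 , 1)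
CS₃-vertex ((1 , 1 , 1) , _)               = refl
CS₃-vertex ((0 , _ , _) , (() , _) , _)
CS₃-vertex ((suc (suc _) , _ , _) , (_ , s≤s ()) , _)
CS₃-vertex ((1 , 0 , _) , _ , (() , _) , _)
CS₃-vertex ((1 , suc (suc _) , _) , _ , (_ , s≤s ()) , _)
CS₃-vertex ((1 , 1 , 0) , _ , _ , () , _)
CS₃-vertex ((1 , 1 , suc (suc _)) , _ , _ , _ , s≤s ())

CS₃-edgeless : ∀ u v → ¬ Adj 3 u v
CS₃-edgeless u v uv with proj₁ u | CS₃-vertex u | proj₁ v | CS₃-vertex v
CS₃-edgeless u v (inj₁ s) | _ | refl | _ | refl = Step-irreflexive s
CS₃-edgeless u v (inj₂ s) | _ | refl | _ | refl = Step-irreflexive s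

CS₃-chromatic : IsChromaticNumber 3 1
CS₃-chromatic =
  ((λ _ → zero) , λ u v uv _ → CS₃-edgeless u v uv) , λ _ → Vertex⇒1≤colours {3} v₁₁₁
  where
  v₁₁₁ : Vertex 3
  v₁₁₁ = (1 , 1 , 1) , (s≤s z≤n , s≤s z≤n) , (s≤s z≤n , s≤s z≤n) , (s≤s z≤n , s≤s z≤n)

CS-chromatic : ∀ n → 4 ≤ n → IsChromaticNumber n 2
CS-chromatic n@(suc (suc (suc (suc _)))) (s≤s (s≤s (s≤s (s≤s z≤n)))) =
  (parityColouring n , parityColouring-proper n) , λ _ → Adj⇒2≤colours {n} v₁₁₁ v₁₁₂ v₁₁₁v₁₁₂
  where
  v₁₁₁ v₁₁₂ : Vertex n
  v₁₁₁ = (1 , 1 , 1) , (s≤s z≤n , s≤s z≤n) , (s≤s z≤n , s≤s z≤n) , (s≤s z≤n , s≤s z≤n)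
  v₁₁₂ = (1 , 1 , 2) , (s≤s z≤n , s≤s z≤n) , (s≤s z≤n , s≤s z≤n) , (s≤s z≤n , s≤s (s≤s z≤n))
  v₁₁₁v₁₁₂ : Adj n v₁₁₁ v₁₁₂
  v₁₁₁v₁₁₂ = inj₁ (inj₁ (refl , refl , refl))

theorem3 : (∀ n → n ≡ 3 → IsChromaticNumber n 1)
           × (∀ n → 4 ≤ n → IsChromaticNumber n 2)
theorem3 = (λ { .3 refl → CS₃-chromatic }) , CS-chromatic
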